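{- Let $k,n,r$ be positive integers with $k \leq n$ and $r \leq k-1$. Let $\mathcal{P}$ be the family of all sets $\{(x_1,y_1),\dots,(x_r,y_r)\}$ such that $x_1,\dots,x_r$ are distinct elements of $[k]$ and $y_1,\dots,y_r$ are distinct elements of $[n]$. Define $\tau \colon [k]\times[n] \to [kn]$ by $\tau(x,y) = k\,\rho(y-x) + x$, where $\rho(y-x) \in \{0,1,\dots,n-1\}$ is the residue of $y-x$ modulo $n$, and for $(\phi,\psi)\in S_k\times S_n$ let $\tau_{\phi,\psi}(x,y) = \tau(\phi^{ -1}(x),\psi^{ -1}(y))$. Let $T_{k,n} = \{\tau_{\phi,\psi} \colon (\phi,\psi) \in S_k \times S_n\}$. Then each member of $\mathcal{P}$ meets exactly $r!\,(k-r)!\,(n-r)!\,kn$ members of $T_{k,n}$.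
   Context: $[m]=\{1,\dots,m\}$ and $S_m$ denotes the set of all bijections $[m]\to[m]$. A cyclic ordering of a finite set $X$ with $|X|=m$ is a bijection $\sigma\colon X\to[m]$. A subset $A=\{z_1,\dots,z_r\}$ of $X$ meets $\sigma$ if its elements are numbered consecutively in the cyclic sense by $\sigma$, i.e. they can be ordered so that $\sigma(z_{i+1}) \equiv \sigma(z_i)+1 \pmod m$ for each $i\in[r-1]$. -}

module Defs where

open import Data.Nat using (ℕ; suc; _%_; NonZero)
open import Data.Nat.Properties using (m*n≢0)
open import Data.Fin using (Fin; toℕ; fromℕ<; combine)
open import Data.Fin.Permutation using (Permutation′; _⟨$⟩ʳ_; _⟨$⟩ˡ_)
open import Data.Integer using (+_; _-_)
open import Data.Integer.DivMod using (_%ℕ_; n%ℕd<d)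
open import Data.Product using (_×_; _,_; ∃; ∃₂)
open import Relation.Binary.PropositionalEquality using (_≡_)

-- Conventions: [m] is represented by Fin m (0-indexed: value i stands for i+1).
-- Shifting every label by one changes neither τ (up to the same shift) nor
-- cyclic consecutiveness.

-- A subset A = {z_1,...,z_r} of X, given by an injective enumeration
-- z : Fin r → X, meets σ : X → [m] if its elements can be ordered
-- (by a permutation π of the indices) so that consecutive ones receive
-- cyclically consecutive labels modulo m.
Meets : {X : Set} {m r : ℕ} .{{_ : NonZero m}} → (X → Fin m) → (Fin r → X) → Set
Meets {m = m} {r = r} σ z =
  ∃ λ (π : Permutation′ r) → ∀ (i j : Fin r) → toℕ j ≡ suc (toℕ i) →
    toℕ (σ (z (π ⟨$⟩ʳ j))) ≡ suc (toℕ (σ (z (π ⟨$⟩ʳ i)))) % m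

ρ : ∀ {k} n .{{_ : NonZero n}} → Fin k → Fin n → Fin n
ρ n x y = fromℕ< (n%ℕd<d (+ toℕ y - + toℕ x) n)

-- τ(x,y) = k ρ(y-x) + x   (toℕ (combine i j) ≡ k * toℕ i + toℕ j)
τ : ∀ k n .{{_ : NonZero n}} → Fin k × Fin n → Fin (n Data.Nat.* k)
τ k n (x , y) = combine (ρ n x y) x

τ[_,_] : ∀ {k n} .{{_ : NonZero n}} → Permutation′ k → Permutation′ n →
         Fin k × Fin n → Fin (n Data.Nat.* k)
τ[_,_] {k} {n} φ ψ (x , y) = τ k n (φ ⟨$⟩ˡ x , ψ ⟨$⟩ˡ y)

InT : ∀ k n .{{_ : NonZero n}} → (Fin k × Fin n → Fin (n Data.Nat.* k)) → Set
InT k n σ = ∃₂ λ (φ : Permutation′ k) (ψ : Permutation′ n) → ∀ p → σ p ≡ τ[ φ , ψ ] p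

MeetsT : ∀ k n .{{_ : NonZero k}} .{{_ : NonZero n}} {r} →
         (Fin k × Fin n → Fin (n Data.Nat.* k)) → (Fin r → Fin k × Fin n) → Set
MeetsT k n σ z = Meets {{m*n≢0 n k}} σ z

module Submission where

-- A member σ of T_{k,n} meets A = {z_1,…,z_r} iff for some start label v and some ordering π
-- of A we have σ(z_{π j}) ≡ v + j (mod kn) for all j.  Writing σ = τ(φ⁻¹ _, ψ⁻¹ _) and
-- inverting τ, whose inverse is t ↦ (t mod k, (⌊t/k⌋ + t mod k) mod n), this says that φ⁻¹
-- sends the ordered first coordinates to the first coordinates of the window τ⁻¹(v), …,
-- τ⁻¹(v + r − 1), and ψ⁻¹ likewise for the second coordinates.  For r ≤ k − 1 ≤ n − 1
-- both windows consist of r distinct values, so for fixed (v, π) there are (k − r)! choices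
-- of φ⁻¹ and (n − r)! of ψ⁻¹.  Since 2r ≤ kn, the labels of A determine v and π, so
-- different parameters (v, π, φ, ψ) give different orderings: kn · r! · (k − r)! · (n − r)!.

open import Defs
open import Data.Nat using (ℕ; zero; suc; _+_; _*_; _∸_; _≤_; _<_; _<?_; z≤n; s≤s; _!; NonZero; >-nonZero⁻¹)
open import Data.Nat.Properties
  using (<⇒≢; <-cmp; ≮⇒≥; <⇒≤; ≤-reflexive; ≤-trans; <-trans; ≤-<-trans; <-≤-trans; n<1+n; m≤m+n; m≤n+m;
         m≤n⇒∃[o]m+o≡n; +-comm; +-assoc; +-suc; +-identityʳ; +-cancelˡ-≡; +-cancelʳ-≡; *-cancelʳ-≡;
         +-cancelˡ-<; +-mono-≤; +-mono-<; +-monoʳ-≤; +-monoˡ-<; *-monoˡ-≤; ∸-monoˡ-≤; m∸n+n≡m; m+n∸n≡m; m*n≢0)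
open import Data.Nat.DivMod
  using (_%_; _/_; m≡m%n+[m/n]*n; [m+kn]%n≡m%n; m<n⇒m%n≡m; m%n<n; %-distribˡ-+; m%n%n≡m%n;
         m≤n⇒[n∸m]%m≡n%m; m∣n⇒o%n%m≡o%m; m%[n*o]/o≡m/o%n)
open import Data.Nat.Divisibility using (n∣m*n)
import Data.Nat.Tactic.RingSolver as ℕ-Solver
open import Data.Integer as ℤ using (ℤ; +_; -[1+_])
import Data.Integer.Properties as ℤ
open import Data.Integer.DivMod using (_%ℕ_; _/ℕ_; a≡a%ℕn+[a/ℕn]*n)
import Data.Integer.Tactic.RingSolver as ℤ-Solver
open import Data.Fin using (Fin; zero; suc; toℕ; fromℕ<; punchIn; punchOut; _≟_)
open import Data.Fin.Properties
  using (toℕ-injective; toℕ<n; toℕ-fromℕ<; fromℕ<-toℕ; toℕ-combine; 0≢1+n; suc-injective;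
         punchIn-injective; punchIn-punchOut; punchOut-injective)
open import Data.Fin.Permutation
  using (Permutation′; _⟨$⟩ʳ_; _⟨$⟩ˡ_; _≈_; id; flip; inverseʳ; insert; remove;
         insert-punchIn; insert-remove; punchIn-permute)
open import Data.Product using (_×_; _,_; ∃; proj₁; proj₂)
open import Data.Product.Relation.Binary.Pointwise.NonDependent using (Pointwise)
open import Data.Sum using (_⊎_; inj₁; inj₂; [_,_])
open import Data.Unit using (⊤; tt)
open import Data.List using (List; []; _∷_; length; map; concatMap; allFin)
open import Data.List.Properties using (length-++; length-map; length-tabulate)
open import Data.List.Relation.Unary.All as All using (All; []; _∷_)
import Data.List.Relation.Unary.All.Properties as All
open import Data.List.Relation.Unary.Any as Any using (Any; here)
import Data.List.Relation.Unary.Any.Properties as Any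
open import Data.List.Relation.Unary.AllPairs as AllPairs using (AllPairs; []; _∷_)
import Data.List.Relation.Unary.AllPairs.Properties as AllPairs
open import Data.List.Relation.Unary.Unique.Propositional.Properties using (allFin⁺)
open import Data.List.Membership.Propositional.Properties using (∈-allFin)
open import Function.Bundles using (Injection)
open import Function.Definitions using (Injective)
open import Function.Properties.Inverse using (↔⇒↣)
open import Relation.Binary using (tri<; tri≈; tri>)
open import Relation.Binary.PropositionalEquality
  using (_≡_; _≢_; _≗_; refl; sym; trans; cong; cong₂; subst; ≢-sym; module ≡-Reasoning)
open import Relation.Nullary using (¬_; yes; no; contradiction)

-- Enumerations up to an equivalence

record Enumeration {A : Set} (_≈_ : A → A → Set) (P : A → Set) (c : ℕ) : Set where
  field
    elements : List A
    size     : length elements ≡ c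
    distinct : AllPairs (λ a b → ¬ a ≈ b) elements
    sound    : All P elements
    complete : ∀ {a} → P a → Any (a ≈_) elements

module _ {A B : Set} where

  pairs : List A → (A → List B) → List (A × B)
  pairs xs f = concatMap (λ a → map (a ,_) (f a)) xs

  length-pairs : ∀ xs (f : A → List B) {c} → (∀ a → length (f a) ≡ c) →
                 length (pairs xs f) ≡ length xs * c
  length-pairs []       f eq = refl
  length-pairs (x ∷ xs) f eq =
    trans (length-++ (map (x ,_) (f x)))
          (cong₂ _+_ (trans (length-map _ (f x)) (eq x)) (length-pairs xs f eq))

  All-pairs : ∀ {P : A × B → Set} {xs} {f : A → List B} →
              All (λ a → All (λ b → P (a , b)) (f a)) xs → All P (pairs xs f)
  All-pairs ps = All.concat⁺ (All.map⁺ (All.map (λ pa → All.map⁺ pa) ps))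

  Any-pairs : ∀ {P : A × B → Set} {xs} {f : A → List B} →
              Any (λ a → Any (λ b → P (a , b)) (f a)) xs → Any P (pairs xs f)
  Any-pairs ps = Any.concat⁺ (Any.map⁺ (Any.map (λ pa → Any.map⁺ pa) ps))

  AllPairs-pairs : ∀ {R : A → A → Set} {S : B → B → Set} {xs} {f : A → List B} →
                   AllPairs R xs → (∀ a → AllPairs S (f a)) →
                   AllPairs (λ p q → R (proj₁ p) (proj₁ q) ⊎ S (proj₂ p) (proj₂ q)) (pairs xs f)
  AllPairs-pairs {R = R} {S} {xs} {f} Rxs Sf =
    AllPairs.concat⁺ (All.map⁺ (All.tabulate (λ {a} _ → AllPairs.map⁺ (AllPairs.map inj₂ (Sf a)))))
                     (AllPairs.map⁺ (AllPairs.map across Rxs))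
    where
    across : ∀ {a a′} → R a a′ →
             All (λ p → All (λ q → R (proj₁ p) (proj₁ q) ⊎ S (proj₂ p) (proj₂ q)) (map (a′ ,_) (f a′)))
                 (map (a ,_) (f a))
    across Raa′ = All.map⁺ (All.tabulate (λ _ → All.map⁺ (All.tabulate (λ _ → inj₁ Raa′))))

allFin-enumeration : ∀ n → Enumeration _≡_ (λ (_ : Fin n) → ⊤) n
allFin-enumeration n = record
  { elements = allFin n
  ; size     = length-tabulate (λ i → i)
  ; distinct = allFin⁺ n
  ; sound    = All.tabulate (λ _ → tt)
  ; complete = λ {i} _ → ∈-allFin i
  }

module _ {A B : Set} {_≈₁_ : A → A → Set} {_≈₂_ : B → B → Set} where

  ×-enumeration : ∀ {P : A → Set} {Q : A → B → Set} {c₁ c₂} →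
                  (∀ {a a′ b} → a ≈₁ a′ → Q a b → Q a′ b) →
                  Enumeration _≈₁_ P c₁ → (∀ a → Enumeration _≈₂_ (Q a) c₂) →
                  Enumeration (Pointwise _≈₁_ _≈₂_) (λ (a , b) → P a × Q a b) (c₁ * c₂)
  ×-enumeration {c₂ = c₂} Q-resp E F = record
    { elements = pairs E.elements (λ a → F.elements a)
    ; size     = trans (length-pairs E.elements _ (λ a → F.size a)) (cong (_* c₂) E.size)
    ; distinct = AllPairs.map [ (λ a≉ eq → a≉ (proj₁ eq)) , (λ b≉ eq → b≉ (proj₂ eq)) ]
                              (AllPairs-pairs E.distinct F.distinct)
    ; sound    = All-pairs (All.map (λ Pa → All.map (Pa ,_) (F.sound _)) E.sound)
    ; complete = λ (Pa , Qab) →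
        Any-pairs (Any.map (λ a≈ → Any.map (a≈ ,_) (F.complete _ (Q-resp a≈ Qab))) (E.complete Pa))
    }
    where
    module E = Enumeration E
    module F a = Enumeration (F a)

  map-enumeration : ∀ {P : A → Set} {Q : B → Set} {c} (f : A → B) →
                    (∀ {a a′} → P a → P a′ → f a ≈₂ f a′ → a ≈₁ a′) →
                    (∀ {a} → P a → Q (f a)) →
                    (∀ {b} → Q b → ∃ λ a → P a × b ≈₂ f a) →
                    (∀ {b a a′} → b ≈₂ f a → a ≈₁ a′ → b ≈₂ f a′) →
                    Enumeration _≈₁_ P c → Enumeration _≈₂_ Q c
  map-enumeration {P = P} f f-injective f-sound f-complete f-resp E = record
    { elements = map f E.elements
    ; size     = trans (length-map f E.elements) E.size
    ; distinct = distinct E.sound E.distinct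
    ; sound    = All.map⁺ (All.map f-sound E.sound)
    ; complete = λ Qb → let a , Pa , b≈ = f-complete Qb in
        Any.map⁺ (Any.map (f-resp b≈) (E.complete Pa))
    }
    where
    module E = Enumeration E
    distinct : ∀ {xs} → All P xs → AllPairs (λ a b → ¬ a ≈₁ b) xs →
               AllPairs (λ a b → ¬ a ≈₂ b) (map f xs)
    distinct []        []          = []
    distinct (Pa ∷ Ps) (a≉ ∷ a≉s) =
      All.map⁺ (All.zipWith (λ (≉ , Pb) eq → ≉ (f-injective Pa Pb eq)) (a≉ , Ps)) ∷ distinct Ps a≉s

-- Permutations extending a partial injection

insert-at : ∀ {m} (i j : Fin (suc m)) (π : Permutation′ m) → insert i j π ⟨$⟩ʳ i ≡ j
insert-at i j π with i ≟ i
... | yes _  = refl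
... | no i≢i = contradiction refl i≢i

insert-cong : ∀ {m} (i j : Fin (suc m)) {π π′ : Permutation′ m} → π ≈ π′ → insert i j π ≈ insert i j π′
insert-cong i j π≈π′ k with i ≟ k
... | yes _  = refl
... | no i≢k = cong (punchIn j) (π≈π′ (punchOut i≢k))

insert-injective : ∀ {m} (i : Fin (suc m)) {j j′} {π π′ : Permutation′ m} →
                   insert i j π ≈ insert i j′ π′ → j ≡ j′ × π ≈ π′
insert-injective i {j} {j′} {π} {π′} eq =
  j≡j′ , λ k → punchIn-injective j _ _ (begin
    punchIn j (π ⟨$⟩ʳ k)             ≡⟨ insert-punchIn i j π k ⟨
    insert i j π ⟨$⟩ʳ punchIn i k     ≡⟨ eq (punchIn i k) ⟩
    insert i j′ π′ ⟨$⟩ʳ punchIn i k   ≡⟨ insert-punchIn i j′ π′ k ⟩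
    punchIn j′ (π′ ⟨$⟩ʳ k)           ≡⟨ cong (λ l → punchIn l (π′ ⟨$⟩ʳ k)) j≡j′ ⟨
    punchIn j (π′ ⟨$⟩ʳ k)            ∎)
  where
  open ≡-Reasoning
  j≡j′ : j ≡ j′
  j≡j′ = trans (sym (insert-at i j π)) (trans (eq i) (insert-at i j′ π′))

permutations : ∀ n → Enumeration _≈_ (λ (_ : Permutation′ n) → ⊤) (n !)
permutations zero = record
  { elements = id ∷ []
  ; size     = refl
  ; distinct = [] ∷ []
  ; sound    = tt ∷ []
  ; complete = λ _ → here (λ ())
  }
permutations (suc n) =
  map-enumeration (λ (j , π) → insert zero j π)
    (λ _ _ eq → insert-injective zero eq)
    (λ _ → tt)
    (λ {p} _ → (p ⟨$⟩ʳ zero , remove zero p) , (tt , tt) , λ k → sym (insert-remove zero p k))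
    (λ { p≈ (refl , π≈π′) k → trans (p≈ k) (insert-cong zero _ π≈π′ k) })
    (×-enumeration (λ _ _ → tt) (allFin-enumeration (suc n)) (λ _ → permutations n))

Extends : ∀ {r n} → (Fin r → Fin n) → (Fin r → Fin n) → Permutation′ n → Set
Extends u w p = ∀ j → p ⟨$⟩ʳ u j ≡ w j

extensions : ∀ {n r} (u w : Fin r → Fin n) → Injective _≡_ _≡_ u → Injective _≡_ _≡_ w →
             Enumeration _≈_ (Extends u w) ((n ∸ r) !)
extensions {n} {zero} u w _ _ = record
  { elements = P.elements
  ; size     = P.size
  ; distinct = P.distinct
  ; sound    = All.map {Q = Extends u w} (λ _ ()) P.sound
  ; complete = λ {p} _ → P.complete {p} tt
  }
  where module P = Enumeration (permutations n)
extensions {zero}  {suc r} u w _ _ with () ← u zero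
extensions {suc n} {suc r} u w u-inj w-inj =
  map-enumeration (insert u₀ w₀)
    (λ _ _ eq → proj₂ (insert-injective u₀ eq))
    sound
    (λ {p} → complete {p})
    (λ {p} p≈ π≈π′ k → trans (p≈ k) (insert-cong u₀ w₀ π≈π′ k))
    (extensions u′ w′ u′-inj w′-inj)
  where
  open ≡-Reasoning
  u₀ = u zero
  w₀ = w zero
  u₀≢ : ∀ j → u₀ ≢ u (suc j)
  u₀≢ j eq = 0≢1+n (u-inj eq)
  w₀≢ : ∀ j → w₀ ≢ w (suc j)
  w₀≢ j eq = 0≢1+n (w-inj eq)
  u′ w′ : Fin r → Fin n
  u′ j = punchOut (u₀≢ j)
  w′ j = punchOut (w₀≢ j)
  u′-inj : Injective _≡_ _≡_ u′
  u′-inj eq = suc-injective (u-inj (punchOut-injective (u₀≢ _) (u₀≢ _) eq))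
  w′-inj : Injective _≡_ _≡_ w′
  w′-inj eq = suc-injective (w-inj (punchOut-injective (w₀≢ _) (w₀≢ _) eq))

  sound : ∀ {π} → Extends u′ w′ π → Extends u w (insert u₀ w₀ π)
  sound {π} ext zero    = insert-at u₀ w₀ π
  sound {π} ext (suc j) = begin
    insert u₀ w₀ π ⟨$⟩ʳ u (suc j)            ≡⟨ cong (insert u₀ w₀ π ⟨$⟩ʳ_) (punchIn-punchOut (u₀≢ j)) ⟨
    insert u₀ w₀ π ⟨$⟩ʳ punchIn u₀ (u′ j)    ≡⟨ insert-punchIn u₀ w₀ π (u′ j) ⟩
    punchIn w₀ (π ⟨$⟩ʳ u′ j)                 ≡⟨ cong (punchIn w₀) (ext j) ⟩
    punchIn w₀ (w′ j)                        ≡⟨ punchIn-punchOut (w₀≢ j) ⟩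
    w (suc j)                                ∎

  complete : ∀ {p} → Extends u w p → ∃ λ π → Extends u′ w′ π × p ≈ insert u₀ w₀ π
  complete {p} ext = remove u₀ p , removed , λ k → trans (sym (insert-remove u₀ p k)) (at-w₀ k)
    where
    removed : Extends u′ w′ (remove u₀ p)
    removed j = punchIn-injective w₀ _ _ (begin
      punchIn w₀ (remove u₀ p ⟨$⟩ʳ u′ j)          ≡⟨ cong (λ l → punchIn l (remove u₀ p ⟨$⟩ʳ u′ j)) (ext zero) ⟨
      punchIn (p ⟨$⟩ʳ u₀) (remove u₀ p ⟨$⟩ʳ u′ j) ≡⟨ punchIn-permute p u₀ (u′ j) ⟨
      p ⟨$⟩ʳ punchIn u₀ (u′ j)                    ≡⟨ cong (p ⟨$⟩ʳ_) (punchIn-punchOut (u₀≢ j)) ⟩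
      p ⟨$⟩ʳ u (suc j)                            ≡⟨ ext (suc j) ⟩
      w (suc j)                                   ≡⟨ punchIn-punchOut (w₀≢ j) ⟨
      punchIn w₀ (w′ j)                           ∎)
    at-w₀ : insert u₀ (p ⟨$⟩ʳ u₀) (remove u₀ p) ≈ insert u₀ w₀ (remove u₀ p)
    at-w₀ k = cong (λ l → insert u₀ l (remove u₀ p) ⟨$⟩ʳ k) (ext zero)

-- Arithmetic modulo n

[m%n+o]%n≡[m+o]%n : ∀ m o n .{{_ : NonZero n}} → (m % n + o) % n ≡ (m + o) % n
[m%n+o]%n≡[m+o]%n m o n = begin
  (m % n + o) % n           ≡⟨ %-distribˡ-+ (m % n) o n ⟩
  (m % n % n + o % n) % n   ≡⟨ cong (λ a → (a + o % n) % n) (m%n%n≡m%n m n) ⟩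
  (m % n + o % n) % n       ≡⟨ %-distribˡ-+ m o n ⟨
  (m + o) % n               ∎
  where open ≡-Reasoning

[m+d]%n≢m%n : ∀ m d n .{{_ : NonZero n}} → 0 < d → d < n → (m + d) % n ≢ m % n
[m+d]%n≢m%n m d n 0<d d<n eq with m % n + d <? n
... | yes s+d<n = <⇒≢ 0<d (sym (+-cancelˡ-≡ s d 0 (begin
  s + d         ≡⟨ m<n⇒m%n≡m s+d<n ⟨
  (s + d) % n   ≡⟨ [m%n+o]%n≡[m+o]%n m d n ⟩
  (m + d) % n   ≡⟨ eq ⟩
  s             ≡⟨ +-identityʳ s ⟨
  s + 0         ∎)))
  where
  open ≡-Reasoning
  s = m % n
... | no s+d≮n = <⇒≢ d<n (+-cancelˡ-≡ s d n (begin
  s + d          ≡⟨ m∸n+n≡m n≤s+d ⟨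
  s + d ∸ n + n  ≡⟨ cong (_+ n) wrapped ⟩
  s + n          ∎))
  where
  open ≡-Reasoning
  s = m % n
  n≤s+d = ≮⇒≥ s+d≮n
  s+d∸n<n : s + d ∸ n < n
  s+d∸n<n = ≤-<-trans (∸-monoˡ-≤ n (+-monoʳ-≤ s (<⇒≤ d<n))) (≤-<-trans (≤-reflexive (m+n∸n≡m s n)) (m%n<n m n))
  wrapped : s + d ∸ n ≡ s
  wrapped = begin
    s + d ∸ n          ≡⟨ m<n⇒m%n≡m s+d∸n<n ⟨
    (s + d ∸ n) % n    ≡⟨ m≤n⇒[n∸m]%m≡n%m n≤s+d ⟩
    (s + d) % n        ≡⟨ [m%n+o]%n≡[m+o]%n m d n ⟩
    (m + d) % n        ≡⟨ eq ⟩
    s                  ∎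

window-apart : ∀ {A : Set} {r} (f : ℕ → A) → (∀ t d → 0 < d → d < r → f (t + d) ≢ f t) →
               ∀ t {a b} → a < b → b < r → f (t + b) ≢ f (t + a)
window-apart f f-moves t {a} a<b b<r with e , refl ← m≤n⇒∃[o]m+o≡n a<b =
  subst (λ u → f u ≢ f (t + a)) (reorder t a e)
        (f-moves (t + a) (suc e) (s≤s z≤n) (≤-<-trans (s≤s (m≤n+m e a)) b<r))
  where
  reorder : ∀ t a e → t + a + suc e ≡ t + (suc a + e)
  reorder = ℕ-Solver.solve-∀

window-injective : ∀ {A : Set} {r} (f : ℕ → A) → (∀ t d → 0 < d → d < r → f (t + d) ≢ f t) →
                   ∀ t {i j} → i < r → j < r → f (t + i) ≡ f (t + j) → i ≡ j
window-injective f f-moves t {i} {j} i<r j<r eq with <-cmp i j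
... | tri< i<j _ _ = contradiction (sym eq) (window-apart f f-moves t i<j j<r)
... | tri≈ _ i≡j _ = i≡j
... | tri> _ _ j<i = contradiction eq (window-apart f f-moves t j<i i<r)

[c+x]%n≡[c′+x]%n⇒c≡c′ : ∀ {c c′} x n .{{_ : NonZero n}} → c < n → c′ < n →
                        (c + x) % n ≡ (c′ + x) % n → c ≡ c′
[c+x]%n≡[c′+x]%n⇒c≡c′ x n = window-injective (λ t → (t + x) % n) shift-moves 0
  where
  reorder : ∀ t x d → t + x + d ≡ t + d + x
  reorder = ℕ-Solver.solve-∀
  shift-moves : ∀ t d → 0 < d → d < n → (t + d + x) % n ≢ (t + x) % n
  shift-moves t d 0<d d<n = subst (λ u → u % n ≢ (t + x) % n) (reorder t x d) ([m+d]%n≢m%n (t + x) d n 0<d d<n)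

divMod-unique : ∀ {t s q} k .{{_ : NonZero k}} → t ≡ s + q * k → s < k → t % k ≡ s × t / k ≡ q
divMod-unique {t} {s} {q} k t≡ s<k = t%k≡s , t/k≡q
  where
  t%k≡s : t % k ≡ s
  t%k≡s = trans (cong (_% k) t≡) (trans ([m+kn]%n≡m%n s q k) (m<n⇒m%n≡m s<k))
  t/k≡q : t / k ≡ q
  t/k≡q = *-cancelʳ-≡ (t / k) q k (+-cancelˡ-≡ s _ _
            (trans (cong (_+ t / k * k) (sym t%k≡s)) (trans (sym (m≡m%n+[m/n]*n t k)) t≡)))

%-congruent : ∀ m a n .{{_ : NonZero n}} (z : ℤ) → + m ≡ + a ℤ.+ z ℤ.* + n → m % n ≡ a % n
%-congruent m a n (+ z) eq = begin
  m % n          ≡⟨ cong (_% n) (ℤ.+-injective (trans eq (sym (as-ℕ a z n)))) ⟩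
  (a + z * n) % n ≡⟨ [m+kn]%n≡m%n a z n ⟩
  a % n          ∎
  where
  open ≡-Reasoning
  as-ℕ : ∀ a z n → + (a + z * n) ≡ + a ℤ.+ + z ℤ.* + n
  as-ℕ a z n = trans (ℤ.pos-+ a (z * n)) (cong (ℤ._+_ (+ a)) (ℤ.pos-* z n))
%-congruent m a n -[1+ z ] eq = sym (%-congruent a m n (+ suc z) (begin
  + a                                                ≡⟨ cancel (+ a) (+ suc z) (+ n) ⟩
  (+ a ℤ.+ ℤ.- + suc z ℤ.* + n) ℤ.+ + suc z ℤ.* + n  ≡⟨ cong (ℤ._+ + suc z ℤ.* + n) eq ⟨
  + m ℤ.+ + suc z ℤ.* + n                            ∎))
  where
  open ≡-Reasoning
  cancel : ∀ a s n → a ≡ (a ℤ.+ ℤ.- s ℤ.* n) ℤ.+ s ℤ.* n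
  cancel = ℤ-Solver.solve-∀

[1+m%n]%n≡[1+m]%n : ∀ m n .{{_ : NonZero n}} → suc (m % n) % n ≡ suc m % n
[1+m%n]%n≡[1+m]%n m n = begin
  suc (m % n) % n   ≡⟨ cong (_% n) (+-comm 1 (m % n)) ⟩
  (m % n + 1) % n   ≡⟨ [m%n+o]%n≡[m+o]%n m 1 n ⟩
  (m + 1) % n       ≡⟨ cong (_% n) (+-comm m 1) ⟩
  suc m % n         ∎
  where open ≡-Reasoning

%-shift-antisym : ∀ {a b} i j n .{{_ : NonZero n}} → a < n → b < n → i + j < n →
                  a ≡ (b + i) % n → b ≡ (a + j) % n → a ≡ b
%-shift-antisym {a} {b} zero    j n a<n b<n i+j<n a≡ b≡ =
  trans a≡ (trans (cong (_% n) (+-identityʳ b)) (m<n⇒m%n≡m b<n))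
%-shift-antisym {a} {b} (suc i) j n a<n b<n i+j<n a≡ b≡ =
  contradiction round-trip ([m+d]%n≢m%n a (j + suc i) n (subst (0 <_) (sym (+-suc j i)) (s≤s z≤n))
                                         (subst (_< n) (+-comm (suc i) j) i+j<n))
  where
  open ≡-Reasoning
  round-trip : (a + (j + suc i)) % n ≡ a % n
  round-trip = begin
    (a + (j + suc i)) % n       ≡⟨ cong (_% n) (+-assoc a j (suc i)) ⟨
    (a + j + suc i) % n         ≡⟨ [m%n+o]%n≡[m+o]%n (a + j) (suc i) n ⟨
    ((a + j) % n + suc i) % n   ≡⟨ cong (λ c → (c + suc i) % n) b≡ ⟨
    (b + suc i) % n             ≡⟨ a≡ ⟨
    a                           ≡⟨ m<n⇒m%n≡m a<n ⟨
    a % n                       ∎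

-- Cyclic orderings

StartsAt : ∀ {X : Set} {m r} .{{_ : NonZero m}} → (X → Fin m) → (Fin r → X) → Fin m → Permutation′ r → Set
StartsAt {m = m} σ z v π = ∀ j → toℕ (σ (z (π ⟨$⟩ʳ j))) ≡ (toℕ v + toℕ j) % m

module _ {X : Set} {m r : ℕ} .{{_ : NonZero m}} (σ : X → Fin m) (z : Fin r → X) where

  startsAt-resp : ∀ {σ′ v π} → σ ≗ σ′ → StartsAt σ z v π → StartsAt σ′ z v π
  startsAt-resp σ≗σ′ at j = trans (cong toℕ (sym (σ≗σ′ _))) (at j)

  startsAt⇒meets : ∀ {v π} → StartsAt σ z v π → Meets σ z
  startsAt⇒meets {v} {π} at = π , λ i j j≡1+i → begin
    toℕ (σ (z (π ⟨$⟩ʳ j)))         ≡⟨ at j ⟩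
    (toℕ v + toℕ j) % m            ≡⟨ cong (λ c → (toℕ v + c) % m) j≡1+i ⟩
    (toℕ v + suc (toℕ i)) % m      ≡⟨ cong (_% m) (+-suc (toℕ v) (toℕ i)) ⟩
    suc (toℕ v + toℕ i) % m        ≡⟨ [1+m%n]%n≡[1+m]%n (toℕ v + toℕ i) m ⟨
    suc ((toℕ v + toℕ i) % m) % m  ≡⟨ cong (λ c → suc c % m) (at i) ⟨
    suc (toℕ (σ (z (π ⟨$⟩ʳ i)))) % m ∎
    where open ≡-Reasoning

meets⇒startsAt : ∀ {X : Set} {m r} .{{_ : NonZero m}} .{{_ : NonZero r}} (σ : X → Fin m) (z : Fin r → X) →
                 Meets σ z → ∃ λ v → ∃ λ π → StartsAt σ z v π
meets⇒startsAt {m = m} {suc r} σ z (π , next) =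
  v , π , λ j → trans (cong (λ i → toℕ (σ (z (π ⟨$⟩ʳ i)))) (sym (fromℕ<-toℕ j (toℕ<n j)))) (at (toℕ j) (toℕ<n j))
  where
  open ≡-Reasoning
  v = σ (z (π ⟨$⟩ʳ zero))
  at : ∀ t (t<r : t < suc r) → toℕ (σ (z (π ⟨$⟩ʳ fromℕ< t<r))) ≡ (toℕ v + t) % m
  at zero    _     = sym (trans (cong (_% m) (+-identityʳ (toℕ v))) (m<n⇒m%n≡m (toℕ<n v)))
  at (suc t) 1+t<r = begin
    toℕ (σ (z (π ⟨$⟩ʳ fromℕ< 1+t<r)))      ≡⟨ next (fromℕ< t<r) (fromℕ< 1+t<r) consecutive ⟩
    suc (toℕ (σ (z (π ⟨$⟩ʳ fromℕ< t<r)))) % m ≡⟨ cong (λ c → suc c % m) (at t t<r) ⟩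
    suc ((toℕ v + t) % m) % m               ≡⟨ [1+m%n]%n≡[1+m]%n (toℕ v + t) m ⟩
    suc (toℕ v + t) % m                     ≡⟨ cong (_% m) (+-suc (toℕ v) t) ⟨
    (toℕ v + suc t) % m                     ∎
    where
    t<r = <-trans (n<1+n t) 1+t<r
    consecutive : toℕ (fromℕ< 1+t<r) ≡ suc (toℕ (fromℕ< t<r))
    consecutive = trans (toℕ-fromℕ< 1+t<r) (cong suc (sym (toℕ-fromℕ< t<r)))

-- z (π 0) is z (π′ i) for some i, so v ≡ v′ + i; symmetrically v′ ≡ v + i′, and i + i′ < r + r ≤ m.
startsAt-unique : ∀ {X : Set} {m r} .{{_ : NonZero m}} .{{_ : NonZero r}} (σ : X → Fin m) (z : Fin r → X) →
                  Injective _≡_ _≡_ σ → Injective _≡_ _≡_ z → r + r ≤ m →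
                  ∀ {v v′ π π′} → StartsAt σ z v π → StartsAt σ z v′ π′ → v ≡ v′ × π ≈ π′
startsAt-unique {m = m} {suc r} σ z σ-inj z-inj 2r≤m {v} {v′} {π} {π′} at at′ =
  v≡v′ , λ j → z-inj (σ-inj (toℕ-injective
    (trans (at j) (trans (cong (λ c → (toℕ c + toℕ j) % m) v≡v′) (sym (at′ j))))))
  where
  open ≡-Reasoning
  offset : ∀ {v v′ π π′} → StartsAt σ z v π → StartsAt σ z v′ π′ →
           toℕ v ≡ (toℕ v′ + toℕ (π′ ⟨$⟩ˡ (π ⟨$⟩ʳ zero))) % m
  offset {v} {v′} {π} {π′} at at′ = begin
    toℕ v                                              ≡⟨ m<n⇒m%n≡m (toℕ<n v) ⟨
    toℕ v % m                                          ≡⟨ cong (_% m) (+-identityʳ (toℕ v)) ⟨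
    (toℕ v + 0) % m                                    ≡⟨ at zero ⟨
    toℕ (σ (z (π ⟨$⟩ʳ zero)))                          ≡⟨ cong (λ c → toℕ (σ (z c))) (inverseʳ π′) ⟨
    toℕ (σ (z (π′ ⟨$⟩ʳ (π′ ⟨$⟩ˡ (π ⟨$⟩ʳ zero)))))      ≡⟨ at′ _ ⟩
    (toℕ v′ + toℕ (π′ ⟨$⟩ˡ (π ⟨$⟩ʳ zero))) % m         ∎
  v≡v′ : v ≡ v′
  v≡v′ = toℕ-injective (%-shift-antisym (toℕ i) (toℕ i′) m (toℕ<n v) (toℕ<n v′)
           (<-≤-trans (+-mono-< (toℕ<n i) (toℕ<n i′)) 2r≤m)
           (offset {v} {v′} {π} {π′} at at′) (offset {v′} {v} {π′} {π} at′ at))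
    where
    i = π′ ⟨$⟩ˡ (π ⟨$⟩ʳ zero)
    i′ = π ⟨$⟩ˡ (π′ ⟨$⟩ʳ zero)

-- The orderings τ_{φ,ψ}

ρ-spec : ∀ {k} n .{{_ : NonZero n}} (x : Fin k) (y : Fin n) → (toℕ (ρ n x y) + toℕ x) % n ≡ toℕ y
ρ-spec n x y = begin
  (toℕ (ρ n x y) + toℕ x) % n  ≡⟨ %-congruent _ (toℕ y) n (ℤ.- q) in-ℤ ⟩
  toℕ y % n                    ≡⟨ m<n⇒m%n≡m (toℕ<n y) ⟩
  toℕ y                        ∎
  where
  open ≡-Reasoning
  X = + toℕ x
  Y = + toℕ y
  i = Y ℤ.- X
  q = i /ℕ n
  reassociate : ∀ c x q n → c ℤ.+ x ≡ ((c ℤ.+ q ℤ.* n) ℤ.+ x) ℤ.+ ℤ.- q ℤ.* n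
  reassociate = ℤ-Solver.solve-∀
  cancel : ∀ y x q n → ((y ℤ.- x) ℤ.+ x) ℤ.+ ℤ.- q ℤ.* n ≡ y ℤ.+ ℤ.- q ℤ.* n
  cancel = ℤ-Solver.solve-∀
  in-ℤ : + (toℕ (ρ n x y) + toℕ x) ≡ Y ℤ.+ ℤ.- q ℤ.* + n
  in-ℤ = begin
    + (toℕ (ρ n x y) + toℕ x)                    ≡⟨ ℤ.pos-+ (toℕ (ρ n x y)) (toℕ x) ⟩
    + toℕ (ρ n x y) ℤ.+ X                         ≡⟨ cong (λ c → + c ℤ.+ X) (toℕ-fromℕ< _) ⟩
    + (i %ℕ n) ℤ.+ X                              ≡⟨ reassociate (+ (i %ℕ n)) X q (+ n) ⟩
    ((+ (i %ℕ n) ℤ.+ q ℤ.* + n) ℤ.+ X) ℤ.+ ℤ.- q ℤ.* + n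
                                                  ≡⟨ cong (λ j → (j ℤ.+ X) ℤ.+ ℤ.- q ℤ.* + n) (a≡a%ℕn+[a/ℕn]*n i n) ⟨
    (i ℤ.+ X) ℤ.+ ℤ.- q ℤ.* + n                   ≡⟨ cancel Y X q (+ n) ⟩
    Y ℤ.+ ℤ.- q ℤ.* + n                           ∎

ρ-unique : ∀ {k} n .{{_ : NonZero n}} (x : Fin k) (y : Fin n) {c} → c < n →
           (c + toℕ x) % n ≡ toℕ y → toℕ (ρ n x y) ≡ c
ρ-unique n x y c<n eq = [c+x]%n≡[c′+x]%n⇒c≡c′ (toℕ x) n (toℕ<n (ρ n x y)) c<n (trans (ρ-spec n x y) (sym eq))

-- From t = k ρ(y − x) + x one reads off x = t mod k, ρ(y − x) = ⌊t/k⌋ and y ≡ ρ(y − x) + x (mod n).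
τ⁻¹ : ∀ k n .{{_ : NonZero k}} .{{_ : NonZero n}} → ℕ → Fin k × Fin n
τ⁻¹ k n t = fromℕ< (m%n<n t k) , fromℕ< (m%n<n (t / k + t % k) n)

instance
  *-nonZero : ∀ {m n} .{{_ : NonZero m}} .{{_ : NonZero n}} → NonZero (m * n)
  *-nonZero {m} {n} = m*n≢0 m n

module _ (k n : ℕ) .{{_ : NonZero k}} .{{_ : NonZero n}} where

  private
    open ≡-Reasoning

    toℕ-τ⁻¹₁ : ∀ t → toℕ (proj₁ (τ⁻¹ k n t)) ≡ t % k
    toℕ-τ⁻¹₁ t = toℕ-fromℕ< _

    toℕ-τ⁻¹₂ : ∀ t → toℕ (proj₂ (τ⁻¹ k n t)) ≡ (t / k + t % k) % n
    toℕ-τ⁻¹₂ t = toℕ-fromℕ< _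

    %nk%k : ∀ t → t % (n * k) % k ≡ t % k
    %nk%k t = m∣n⇒o%n%m≡o%m k (n * k) t (n∣m*n n)

    %nk/k : ∀ t → t % (n * k) / k ≡ t / k % n
    %nk/k t = m%[n*o]/o≡m/o%n t n k

  τ⁻¹-τ : ∀ P → τ⁻¹ k n (toℕ (τ k n P)) ≡ P
  τ⁻¹-τ (x , y) = cong₂ _,_ (toℕ-injective (trans (toℕ-τ⁻¹₁ t) t%k≡x)) (toℕ-injective (begin
    toℕ (proj₂ (τ⁻¹ k n t))   ≡⟨ toℕ-τ⁻¹₂ t ⟩
    (t / k + t % k) % n       ≡⟨ cong₂ (λ a b → (a + b) % n) t/k≡c t%k≡x ⟩
    (c + toℕ x) % n           ≡⟨ ρ-spec n x y ⟩
    toℕ y                     ∎))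
    where
    t = toℕ (τ k n (x , y))
    c = toℕ (ρ n x y)
    swap : ∀ k a b → k * a + b ≡ b + a * k
    swap = ℕ-Solver.solve-∀
    t≡ : t ≡ toℕ x + c * k
    t≡ = trans (toℕ-combine (ρ n x y) x) (swap k c (toℕ x))
    t%k≡x : t % k ≡ toℕ x
    t%k≡x = proj₁ (divMod-unique {q = c} k t≡ (toℕ<n x))
    t/k≡c : t / k ≡ c
    t/k≡c = proj₂ (divMod-unique {q = c} k t≡ (toℕ<n x))

  τ-τ⁻¹ : ∀ t → toℕ (τ k n (τ⁻¹ k n t)) ≡ t % (n * k)
  τ-τ⁻¹ t = begin
    toℕ (τ k n (x , y))               ≡⟨ toℕ-combine (ρ n x y) x ⟩
    k * toℕ (ρ n x y) + toℕ x          ≡⟨ cong₂ (λ a b → k * a + b) ρ≡ (toℕ-τ⁻¹₁ t) ⟩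
    k * (t / k % n) + t % k            ≡⟨ cong₂ (λ a b → k * a + b) (%nk/k t) (%nk%k t) ⟨
    k * (t % (n * k) / k) + t % (n * k) % k
                                       ≡⟨ swap k (t % (n * k) / k) (t % (n * k) % k) ⟩
    t % (n * k) % k + t % (n * k) / k * k
                                       ≡⟨ m≡m%n+[m/n]*n (t % (n * k)) k ⟨
    t % (n * k)                        ∎
    where
    x = proj₁ (τ⁻¹ k n t)
    y = proj₂ (τ⁻¹ k n t)
    swap : ∀ k a b → k * a + b ≡ b + a * k
    swap = ℕ-Solver.solve-∀
    ρ≡ : toℕ (ρ n x y) ≡ t / k % n
    ρ≡ = ρ-unique n x y (m%n<n (t / k) n) (begin
      (t / k % n + toℕ x) % n   ≡⟨ cong (λ a → (t / k % n + a) % n) (toℕ-τ⁻¹₁ t) ⟩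
      (t / k % n + t % k) % n   ≡⟨ [m%n+o]%n≡[m+o]%n (t / k) (t % k) n ⟩
      (t / k + t % k) % n       ≡⟨ toℕ-τ⁻¹₂ t ⟨
      toℕ y                     ∎)

  τ⁻¹-% : ∀ t → τ⁻¹ k n (t % (n * k)) ≡ τ⁻¹ k n t
  τ⁻¹-% t = cong₂ _,_ (toℕ-injective (trans (toℕ-τ⁻¹₁ _) (trans (%nk%k t) (sym (toℕ-τ⁻¹₁ t)))))
                      (toℕ-injective (begin
    toℕ (proj₂ (τ⁻¹ k n (t % (n * k))))           ≡⟨ toℕ-τ⁻¹₂ _ ⟩
    (t % (n * k) / k + t % (n * k) % k) % n       ≡⟨ cong₂ (λ a b → (a + b) % n) (%nk/k t) (%nk%k t) ⟩
    (t / k % n + t % k) % n                       ≡⟨ [m%n+o]%n≡[m+o]%n (t / k) (t % k) n ⟩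
    (t / k + t % k) % n                           ≡⟨ toℕ-τ⁻¹₂ t ⟨
    toℕ (proj₂ (τ⁻¹ k n t))                       ∎))

  τ-injective : ∀ {P P′} → τ k n P ≡ τ k n P′ → P ≡ P′
  τ-injective {P} {P′} eq = trans (sym (τ⁻¹-τ P)) (trans (cong (λ c → τ⁻¹ k n (toℕ c)) eq) (τ⁻¹-τ P′))

  τ⁻¹₁-moves : ∀ t d → 0 < d → d < k → proj₁ (τ⁻¹ k n (t + d)) ≢ proj₁ (τ⁻¹ k n t)
  τ⁻¹₁-moves t d 0<d d<k eq =
    [m+d]%n≢m%n t d k 0<d d<k (trans (sym (toℕ-τ⁻¹₁ (t + d))) (trans (cong toℕ eq) (toℕ-τ⁻¹₁ t)))

  private
    diag : ℕ → ℕ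
    diag t = t / k + t % k

    diag-step : ∀ t d → t % k + d < k → diag (t + d) ≡ diag t + d
    diag-step t d s+d<k = begin
      (t + d) / k + (t + d) % k   ≡⟨ cong₂ _+_ (proj₂ divmod) (proj₁ divmod) ⟩
      t / k + (t % k + d)         ≡⟨ +-assoc (t / k) (t % k) d ⟨
      t / k + t % k + d           ∎
      where
      reorder : ∀ s m d → s + m + d ≡ s + d + m
      reorder = ℕ-Solver.solve-∀
      divmod = divMod-unique {q = t / k} k
                 (trans (cong (_+ d) (m≡m%n+[m/n]*n t k)) (reorder (t % k) (t / k * k) d)) s+d<k

    diag-wrap : ∀ t d e → suc d + e ≡ k → k ≤ t % k + d → diag (t + d) + e ≡ diag t
    diag-wrap t d e de≡k k≤s+d with v , kv≡s+d ← m≤n⇒∃[o]m+o≡n k≤s+d =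
      +-cancelʳ-≡ d _ _ (begin
        (t + d) / k + (t + d) % k + e + d   ≡⟨ cong₂ (λ a b → a + b + e + d) (proj₂ divmod) (proj₁ divmod) ⟩
        suc q + v + e + d                   ≡⟨ reorder₁ q v e d ⟩
        q + v + (suc d + e)                 ≡⟨ cong (λ a → q + v + a) de≡k ⟩
        q + v + k                           ≡⟨ reorder₂ q v k ⟩
        q + (k + v)                         ≡⟨ cong (λ a → q + a) kv≡s+d ⟩
        q + (s + d)                         ≡⟨ +-assoc q s d ⟨
        q + s + d                           ∎)
      where
      s = t % k
      q = t / k
      reorder₁ : ∀ q v e d → suc q + v + e + d ≡ q + v + (suc d + e)
      reorder₁ = ℕ-Solver.solve-∀
      reorder₂ : ∀ q v k → q + v + k ≡ q + (k + v)
      reorder₂ = ℕ-Solver.solve-∀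
      reorder₃ : ∀ s m d → s + m + d ≡ s + d + m
      reorder₃ = ℕ-Solver.solve-∀
      reorder₄ : ∀ k v m → k + v + m ≡ v + (k + m)
      reorder₄ = ℕ-Solver.solve-∀
      v<k : v < k
      v<k = <-trans (+-cancelˡ-< k v d (subst (_< k + d) (sym kv≡s+d) (+-monoˡ-< d (m%n<n t k))))
                    (≤-trans (s≤s (m≤m+n d e)) (≤-reflexive de≡k))
      divmod = divMod-unique {q = suc q} k (begin
        t + d            ≡⟨ cong (_+ d) (m≡m%n+[m/n]*n t k) ⟩
        s + q * k + d    ≡⟨ reorder₃ s (q * k) d ⟩
        s + d + q * k    ≡⟨ cong (_+ q * k) kv≡s+d ⟨
        k + v + q * k    ≡⟨ reorder₄ k v (q * k) ⟩
        v + suc q * k    ∎) v<k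

    -- diag increases by 1 inside a block of k consecutive t and drops by k − 2 across a block
    -- boundary; for d + 1 < k ≤ n neither total change is a multiple of n.
    diag-moves : k ≤ n → ∀ t d → 0 < d → suc d < k → diag (t + d) % n ≢ diag t % n
    diag-moves k≤n t d 0<d 1+d<k with t % k + d <? k
    ... | yes s+d<k = subst (λ a → a % n ≢ diag t % n) (sym (diag-step t d s+d<k))
                        ([m+d]%n≢m%n (diag t) d n 0<d (<-≤-trans (<-trans (n<1+n d) 1+d<k) k≤n))
    ... | no s+d≮k with e , de≡k ← m≤n⇒∃[o]m+o≡n 1+d<k =
      subst (λ a → diag (t + d) % n ≢ a % n) (diag-wrap t d (suc e) (trans (+-suc (suc d) e) de≡k) (≮⇒≥ s+d≮k))
            (≢-sym ([m+d]%n≢m%n (diag (t + d)) (suc e) n (s≤s z≤n)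
                     (≤-trans (s≤s (s≤s (m≤n+m e d))) (≤-trans (≤-reflexive de≡k) k≤n))))

  τ⁻¹₂-moves : k ≤ n → ∀ t d → 0 < d → suc d < k → proj₂ (τ⁻¹ k n (t + d)) ≢ proj₂ (τ⁻¹ k n t)
  τ⁻¹₂-moves k≤n t d 0<d 1+d<k eq =
    diag-moves k≤n t d 0<d 1+d<k (trans (sym (toℕ-τ⁻¹₂ (t + d))) (trans (cong toℕ eq) (toℕ-τ⁻¹₂ t)))

-- τ⟨ p , q ⟩ is τ[ flip p , flip q ]: the permutations are the inverses φ⁻¹, ψ⁻¹ of the paper.
τ⟨_,_⟩ : ∀ {k n} .{{_ : NonZero n}} → Permutation′ k → Permutation′ n → Fin k × Fin n → Fin (n * k)
τ⟨_,_⟩ {k} {n} p q (x , y) = τ k n (p ⟨$⟩ʳ x , q ⟨$⟩ʳ y)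

τ⟨⟩-injective : ∀ {k n} .{{_ : NonZero k}} .{{_ : NonZero n}} (p : Permutation′ k) (q : Permutation′ n) →
                Injective _≡_ _≡_ τ⟨ p , q ⟩
τ⟨⟩-injective {k} {n} p q eq = cong₂ _,_ (Injection.injective (↔⇒↣ p) (cong proj₁ P≡P′))
                                         (Injection.injective (↔⇒↣ q) (cong proj₂ P≡P′))
  where P≡P′ = τ-injective k n eq

τ⟨⟩-cancel : ∀ {k n} .{{_ : NonZero k}} .{{_ : NonZero n}} {p p′ : Permutation′ k} {q q′ : Permutation′ n} →
             τ⟨ p , q ⟩ ≗ τ⟨ p′ , q′ ⟩ → p ≈ p′ × q ≈ q′
τ⟨⟩-cancel {suc k} {suc n} {p} {p′} {q} {q′} eq =
  (λ x → cong proj₁ (τ-injective (suc k) (suc n) {_ , q ⟨$⟩ʳ zero} {_ , q′ ⟨$⟩ʳ zero} (eq (x , zero)))) ,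
  (λ y → cong proj₂ (τ-injective (suc k) (suc n) {p ⟨$⟩ʳ zero , _} {p′ ⟨$⟩ʳ zero , _} (eq (zero , y))))

-- Counting the members of T_{k,n} that meet {(xs i , ys i)}

module Counting (k n r : ℕ) .{{_ : NonZero k}} .{{_ : NonZero n}} .{{_ : NonZero r}}
                (k≤n : k ≤ n) (r<k : r < k) (xs : Fin r → Fin k) (ys : Fin r → Fin n)
                (xs-injective : Injective _≡_ _≡_ xs) (ys-injective : Injective _≡_ _≡_ ys) where

  open ≡-Reasoning

  z : Fin r → Fin k × Fin n
  z i = xs i , ys i

  window₁ : Fin (n * k) → Fin r → Fin k
  window₁ v j = proj₁ (τ⁻¹ k n (toℕ v + toℕ j))

  window₂ : Fin (n * k) → Fin r → Fin n
  window₂ v j = proj₂ (τ⁻¹ k n (toℕ v + toℕ j))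

  window₁-injective : ∀ v → Injective _≡_ _≡_ (window₁ v)
  window₁-injective v eq = toℕ-injective (window-injective (λ t → proj₁ (τ⁻¹ k n t))
    (λ t d 0<d d<r → τ⁻¹₁-moves k n t d 0<d (<-trans d<r r<k)) (toℕ v) (toℕ<n _) (toℕ<n _) eq)

  window₂-injective : ∀ v → Injective _≡_ _≡_ (window₂ v)
  window₂-injective v eq = toℕ-injective (window-injective (λ t → proj₂ (τ⁻¹ k n t))
    (λ t d 0<d d<r → τ⁻¹₂-moves k n k≤n t d 0<d (≤-<-trans d<r r<k)) (toℕ v) (toℕ<n _) (toℕ<n _) eq)

  Admissible : Fin (n * k) → Permutation′ r → Permutation′ k × Permutation′ n → Set
  Admissible v π (p , q) = Extends (λ j → xs (π ⟨$⟩ʳ j)) (window₁ v) p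
                         × Extends (λ j → ys (π ⟨$⟩ʳ j)) (window₂ v) q

  admissible⇒startsAt : ∀ {v π p q} → Admissible v π (p , q) → StartsAt τ⟨ p , q ⟩ z v π
  admissible⇒startsAt {v} {π} {p} {q} (ext₁ , ext₂) j = begin
    toℕ (τ k n (p ⟨$⟩ʳ xs (π ⟨$⟩ʳ j) , q ⟨$⟩ʳ ys (π ⟨$⟩ʳ j)))
      ≡⟨ cong (λ P → toℕ (τ k n P)) (cong₂ _,_ (ext₁ j) (ext₂ j)) ⟩
    toℕ (τ k n (τ⁻¹ k n (toℕ v + toℕ j)))
      ≡⟨ τ-τ⁻¹ k n (toℕ v + toℕ j) ⟩
    (toℕ v + toℕ j) % (n * k)
      ∎

  startsAt⇒admissible : ∀ {v π p q} → StartsAt τ⟨ p , q ⟩ z v π → Admissible v π (p , q)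
  startsAt⇒admissible {v} {π} {p} {q} at = (λ j → cong proj₁ (decoded j)) , (λ j → cong proj₂ (decoded j))
    where
    decoded : ∀ j → (p ⟨$⟩ʳ xs (π ⟨$⟩ʳ j) , q ⟨$⟩ʳ ys (π ⟨$⟩ʳ j)) ≡ τ⁻¹ k n (toℕ v + toℕ j)
    decoded j = begin
      (p ⟨$⟩ʳ xs (π ⟨$⟩ʳ j) , q ⟨$⟩ʳ ys (π ⟨$⟩ʳ j))  ≡⟨ τ⁻¹-τ k n _ ⟨
      τ⁻¹ k n (toℕ (τ⟨ p , q ⟩ (z (π ⟨$⟩ʳ j))))       ≡⟨ cong (τ⁻¹ k n) (at j) ⟩
      τ⁻¹ k n ((toℕ v + toℕ j) % (n * k))             ≡⟨ τ⁻¹-% k n (toℕ v + toℕ j) ⟩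
      τ⁻¹ k n (toℕ v + toℕ j)                         ∎

  extends-reorder : ∀ {m} {u : Fin r → Fin m} {w} {p : Permutation′ m} {π π′ : Permutation′ r} →
                    π ≈ π′ → Extends (λ j → u (π ⟨$⟩ʳ j)) w p → Extends (λ j → u (π′ ⟨$⟩ʳ j)) w p
  extends-reorder {u = u} {p = p} π≈π′ ext j = trans (cong (λ i → p ⟨$⟩ʳ u i) (sym (π≈π′ j))) (ext j)

  Parameters : Set
  Parameters = Fin (n * k) × Permutation′ r × Permutation′ k × Permutation′ n

  _≈ᴾ_ : Parameters → Parameters → Set
  _≈ᴾ_ = Pointwise _≡_ (Pointwise _≈_ (Pointwise _≈_ _≈_))

  -- The two ⊤ factors are the (trivial) conditions on v and π imposed by the nested ×-enumeration.
  AdmissibleParameters : Parameters → Set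
  AdmissibleParameters (v , π , pq) = ⊤ × ⊤ × Admissible v π pq

  admissible-parameters : Enumeration _≈ᴾ_ AdmissibleParameters (n * k * (r ! * ((k ∸ r) ! * (n ∸ r) !)))
  admissible-parameters =
    ×-enumeration (λ { refl adm → adm }) (allFin-enumeration (n * k)) λ v →
    ×-enumeration (λ { {π} {π′} {p , q} π≈π′ (ext₁ , ext₂) →
                       extends-reorder {u = xs} {p = p} {π} {π′} π≈π′ ext₁ ,
                       extends-reorder {u = ys} {p = q} {π} {π′} π≈π′ ext₂ })
                  (permutations r) λ π →
    ×-enumeration (λ _ ext → ext)
                  (extensions _ (window₁ v) (λ eq → Injection.injective (↔⇒↣ π) (xs-injective eq))
                              (window₁-injective v)) λ _ →
    extensions _ (window₂ v) (λ eq → Injection.injective (↔⇒↣ π) (ys-injective eq)) (window₂-injective v)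

  r+r≤nk : r + r ≤ n * k
  r+r≤nk = ≤-trans (+-mono-≤ (<⇒≤ r<k) (<⇒≤ r<k)) (≤-trans (≤-reflexive (k+k≡2*k k)) (*-monoˡ-≤ k 2≤n))
    where
    k+k≡2*k : ∀ k → k + k ≡ 2 * k
    k+k≡2*k = ℕ-Solver.solve-∀
    2≤n : 2 ≤ n
    2≤n = ≤-trans (s≤s (>-nonZero⁻¹ r)) (≤-trans r<k k≤n)

  member : Parameters → Fin k × Fin n → Fin (n * k)
  member (_ , _ , p , q) = τ⟨ p , q ⟩

  member-injective : ∀ {a a′} → AdmissibleParameters a → AdmissibleParameters a′ →
                     member a ≗ member a′ → a ≈ᴾ a′
  member-injective {v , π , p , q} {v′ , π′ , p′ , q′} (_ , _ , adm) (_ , _ , adm′) eq =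
    v≡v′ , π≈π′ , τ⟨⟩-cancel {p = p} {p′} {q} {q′} eq
    where
    z-injective : Injective _≡_ _≡_ z
    z-injective eq = xs-injective (cong proj₁ eq)
    unique = startsAt-unique τ⟨ p , q ⟩ z (τ⟨⟩-injective p q) z-injective r+r≤nk {v} {v′} {π} {π′}
               (admissible⇒startsAt {v} {π} {p} {q} adm)
               (startsAt-resp τ⟨ p′ , q′ ⟩ z {τ⟨ p , q ⟩} {v′} {π′} (λ P → sym (eq P))
                              (admissible⇒startsAt {v′} {π′} {p′} {q′} adm′))
    v≡v′ = proj₁ unique
    π≈π′ = proj₂ unique

  member-sound : ∀ {a} → AdmissibleParameters a → InT k n (member a) × MeetsT k n (member a) z
  member-sound {v , π , p , q} (_ , _ , adm) =
    (flip p , flip q , λ _ → refl) ,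
    startsAt⇒meets τ⟨ p , q ⟩ z {v} {π} (admissible⇒startsAt {v} {π} {p} {q} adm)

  member-complete : ∀ {σ} → InT k n σ × MeetsT k n σ z → ∃ λ a → AdmissibleParameters a × σ ≗ member a
  member-complete {σ} ((φ , ψ , σ≗) , meets) =
    (v , π , flip φ , flip ψ) ,
    (tt , tt , startsAt⇒admissible {v} {π} {flip φ} {flip ψ} (startsAt-resp σ z {τ[ φ , ψ ]} {v} {π} σ≗ at)) ,
    σ≗
    where
    start = meets⇒startsAt σ z meets
    v = proj₁ start
    π = proj₁ (proj₂ start)
    at = proj₂ (proj₂ start)

  member-resp : ∀ {σ a a′} → σ ≗ member a → a ≈ᴾ a′ → σ ≗ member a′
  member-resp σ≗ (_ , _ , p≈p′ , q≈q′) (x , y) =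
    trans (σ≗ (x , y)) (cong₂ (λ a b → τ k n (a , b)) (p≈p′ x) (q≈q′ y))

  meeting-members : Enumeration _≗_ (λ σ → InT k n σ × MeetsT k n σ z)
                                    (n * k * (r ! * ((k ∸ r) ! * (n ∸ r) !)))
  meeting-members = map-enumeration member
    (λ {a} {a′} → member-injective {a} {a′}) (λ {a} → member-sound {a}) member-complete
    (λ {σ} {a} {a′} → member-resp {σ} {a} {a′}) admissible-parameters

lemma6 : ∀ (k n r : ℕ) .{{_ : NonZero k}} .{{_ : NonZero n}} → 1 ≤ r → k ≤ n → r ≤ k ∸ 1 →
         (xs : Fin r → Fin k) (ys : Fin r → Fin n) →
         Injective _≡_ _≡_ xs → Injective _≡_ _≡_ ys →
         ∃ λ (L : List (Fin k × Fin n → Fin (n * k))) →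
           length L ≡ (r !) * ((k ∸ r) !) * ((n ∸ r) !) * (k * n)
           × AllPairs (λ σ σ′ → ¬ (σ ≗ σ′)) L
           × All (λ σ → InT k n σ × MeetsT k n σ (λ i → xs i , ys i)) L
           × (∀ σ → InT k n σ → MeetsT k n σ (λ i → xs i , ys i) → Any (σ ≗_) L)
lemma6 (suc k) n (suc r) (s≤s z≤n) k≤n r≤k xs ys xs-injective ys-injective =
  elements , trans size (reorder (suc k) n (suc r !) ((suc k ∸ suc r) !) ((n ∸ suc r) !)) ,
  distinct , sound , λ σ inT meets → complete (inT , meets)
  where
  open Enumeration (Counting.meeting-members (suc k) n (suc r) k≤n (s≤s r≤k) xs ys xs-injective ys-injective)
  reorder : ∀ k n a b c → n * k * (a * (b * c)) ≡ a * b * c * (k * n)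
  reorder = ℕ-Solver.solve-∀
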